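{- Fix an integer $d\geq 1$. The family $\{\mathrm{PHP}^{n+d}_n\}_{n\in\mathbb N}$ is $1$-self-reducible: for every set $I$ of variables of $\mathrm{PHP}^{n+d}_n$ with $|I|=v<n$ there is a restriction $\rho$ with domain $\supseteq I$ such that $\mathrm{PHP}^{n+d}_n\restriction_\rho=\mathrm{PHP}^{n-v+d}_{n-v}$ up to renaming of variables.
   Context: $\mathrm{PHP}^m_n$ ($m>n$) is the set of integer linear inequalities over variables $P_{i,j}$, $i\in[m]$, $j\in[n]$: $\sum_{j=1}^n P_{i,j}\geq 1$ for all $i\in[m]$, and $P_{i,k}+P_{j,k}\leq 1$ for all $k\in[n]$ and $i\neq j\in[m]$. A restriction is a map $\rho:D\to\{0,1\}$ on a subset $D$ of the variables; $\mathcal{F}\restriction_\rho$ is obtained by substituting these values into every inequality of $\mathcal{F}$. -}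

module Defs where

open import Data.Nat as ℕ using (ℕ; zero; suc)
open import Data.Integer as ℤ using (ℤ; _+_; _*_; _-_; _≤_; -_; 0ℤ; 1ℤ)
open import Data.Fin as Fin using (Fin)
open import Data.Bool using (Bool; true; false; if_then_else_; _∧_; _∨_)
open import Data.Maybe using (Maybe; just; nothing)
open import Data.Product using (Σ; _×_; _,_; proj₁; proj₂)
open import Data.Sum using (_⊎_; inj₁; inj₂)
open import Relation.Nullary using (¬_)
open import Relation.Nullary.Decidable using (⌊_⌋)
open import Relation.Binary.PropositionalEquality using (_≡_; _≢_)
open import Function.Bundles using (_↔_)

sumFin : ∀ {n} → (Fin n → ℤ) → ℤ
sumFin {zero}  f = 0ℤ
sumFin {suc n} f = f Fin.zero + sumFin (λ i → f (Fin.suc i))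

sumVar : ∀ {m n} → (Fin m → Fin n → ℤ) → ℤ
sumVar f = sumFin (λ i → sumFin (λ j → f i j))

⟦_⟧ : Bool → ℤ
⟦ b ⟧ = if b then 1ℤ else 0ℤ

-- An integer linear inequality over the variables P_{i,j}, i ∈ [m], j ∈ [n],
-- in the normal form   Σ_{i,j} coeff i j · P_{i,j}  ≥  bound.
record Ineq (m n : ℕ) : Set where
  constructor ineq
  field
    coeff : Fin m → Fin n → ℤ
    bound : ℤ
open Ineq public

record Formula (m n : ℕ) : Set₁ where
  constructor formula
  field
    Idx : Set
    ax  : Idx → Ineq m n
open Formula public

-- The pigeonhole principle PHP^m_n.
--   pigeon axioms:  Σ_j P_{i,j} ≥ 1                (i ∈ [m])
--   hole axioms:    P_{i,k} + P_{j,k} ≤ 1, written as  -P_{i,k} - P_{j,k} ≥ -1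
--                   (k ∈ [n], i ≠ j ∈ [m])
PHPIdx : ℕ → ℕ → Set
PHPIdx m n = Fin m ⊎ (Fin n × Σ (Fin m × Fin m) (λ p → proj₁ p ≢ proj₂ p))

PHPax : ∀ m n → PHPIdx m n → Ineq m n
PHPax m n (inj₁ i) = ineq (λ i' j' → if ⌊ i' Fin.≟ i ⌋ then 1ℤ else 0ℤ) 1ℤ
PHPax m n (inj₂ (k , (i , j) , _)) =
  ineq (λ i' j' → if ⌊ j' Fin.≟ k ⌋ ∧ (⌊ i' Fin.≟ i ⌋ ∨ ⌊ i' Fin.≟ j ⌋)
                  then - 1ℤ else 0ℤ)
       (- 1ℤ)

PHP : ∀ m n → Formula m n
PHP m n = formula (PHPIdx m n) (PHPax m n)

-- A restriction: a partial assignment; the domain is the set of variables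
-- mapped to `just _`.
Restriction : ℕ → ℕ → Set
Restriction m n = Fin m → Fin n → Maybe Bool

assignedVal : ∀ {m n} → Restriction m n → (Ineq m n) → Fin m → Fin n → ℤ
assignedVal ρ e i j with ρ i j
... | just b  = coeff e i j * ⟦ b ⟧
... | nothing = 0ℤ

freeCoeff : ∀ {m n} → Restriction m n → (Ineq m n) → Fin m → Fin n → ℤ
freeCoeff ρ e i j with ρ i j
... | just _  = 0ℤ
... | nothing = coeff e i j

restrictIneq : ∀ {m n} → Restriction m n → Ineq m n → Ineq m n
restrictIneq ρ e = ineq (freeCoeff ρ e) (bound e - sumVar (assignedVal ρ e))

_↾_ : ∀ {m n} → Formula m n → Restriction m n → Formula m n
F ↾ ρ = formula (Idx F) (λ k → restrictIneq ρ (ax F k))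

InDom : ∀ {m n} → Restriction m n → Fin m × Fin n → Set
InDom ρ (i , j) = ρ i j ≢ nothing

Free : ∀ {m n} → Restriction m n → Set
Free {m} {n} ρ = Σ (Fin m × Fin n) (λ p → ρ (proj₁ p) (proj₂ p) ≡ nothing)

Holds : ∀ {m n} → (Fin m → Fin n → Bool) → Ineq m n → Set
Holds α e = bound e ≤ sumVar (λ i j → coeff e i j * ⟦ α i j ⟧)

-- An inequality satisfied by every 0/1 assignment (e.g. constant 1 ≥ 1,
-- 0 ≥ -1, or P ≤ 1); such trivially true inequalities are discarded.
Trivial : ∀ {m n} → Ineq m n → Set
Trivial e = ∀ α → Holds α e

RenamedEq : ∀ {m n m' n'} (ρ : Restriction m n) →
            (Free ρ ↔ (Fin m' × Fin n')) → Ineq m n → Ineq m' n' → Set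
RenamedEq ρ σ e f =
  (bound e ≡ bound f) ×
  (∀ (x : Free ρ) → coeff e (proj₁ (proj₁ x)) (proj₂ (proj₁ x))
                   ≡ coeff f (proj₁ (Inverse.to σ x)) (proj₂ (Inverse.to σ x)))
  where open import Function.Bundles using (Inverse)

-- F ↾ ρ = G up to the renaming σ of the free variables of ρ
-- (as sets of inequalities, discarding trivially true inequalities of F ↾ ρ).
EqUpToRenaming : ∀ {m n m' n'} (F : Formula m n) (ρ : Restriction m n) →
                 Formula m' n' → (Free ρ ↔ (Fin m' × Fin n')) → Set
EqUpToRenaming F ρ G σ =
  (∀ (k : Idx (F ↾ ρ)) → ¬ Trivial (ax (F ↾ ρ) k) →
      Σ (Idx G) (λ l → RenamedEq ρ σ (ax (F ↾ ρ) k) (ax G l))) ×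
  (∀ (l : Idx G) →
      Σ (Idx (F ↾ ρ)) (λ k → RenamedEq ρ σ (ax (F ↾ ρ) k) (ax G l)))

-- Rank the pigeons by a permutation that sends every pigeon occurring in I
-- below v = |I|, and rank the holes in their natural order. Matching the
-- pigeon of rank c < v with the hole of rank c, and setting every other
-- variable of a low-ranked pigeon or hole to 0, assigns all of I. Each axiom
-- touching a matched pigeon or hole becomes trivially true (a pigeon axiom
-- sees its single 1, a hole axiom becomes -P ≥ -1 or a constant), while the
-- axioms on the n - v + d high-ranked pigeons and the n - v high-ranked holes
-- are untouched: they form PHP^{n-v+d}_{n-v} after shifting ranks down by v.
module Submission where

open import Defs
open import Data.Nat using (ℕ; _+_; _∸_; _≤_; _<_)
open import Data.Fin using (Fin)
open import Data.List using (List; length)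
open import Data.List.Membership.Propositional using (_∈_)
open import Data.List.Relation.Unary.Unique.Propositional using (Unique)
open import Data.Product using (Σ; _×_)
open import Function.Bundles using (_↔_)

open import Axiom.UniquenessOfIdentityProofs using (module Decidable⇒UIP)
open import Data.Bool using (Bool; true; false; if_then_else_; _∧_; _∨_)
import Data.Bool.Properties as Boolₚ
open import Data.Empty using (⊥-elim)
import Data.Fin as Fin
open import Data.Fin using (toℕ; fromℕ<; splitAt; _↑ˡ_; _↑ʳ_)
open import Data.Fin.Permutation
  using ( Permutation; Permutation′; _⟨$⟩ʳ_; _⟨$⟩ˡ_; inverseˡ; inverseʳ
        ; id; _∘ₚ_; cast-id; transpose)
import Data.Fin.Permutation.Components as PC
open import Data.Fin.Properties
  using ( suc-injective; toℕ-fromℕ<; toℕ-cast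
        ; splitAt-↑ˡ; splitAt-↑ʳ; splitAt⁻¹-↑ˡ; splitAt⁻¹-↑ʳ; splitAt-<)
open import Data.Integer using (ℤ; 0ℤ; 1ℤ; -_; -≤+)
import Data.Integer as ℤ
import Data.Integer.Properties as ℤₚ
open import Data.List using ([]; _∷_; map)
open import Data.List.Membership.Propositional.Properties using (∈-map⁺)
open import Data.List.Properties using (length-map)
open import Data.List.Relation.Unary.Any using (here; there)
open import Data.Maybe using (Maybe; just; nothing)
open import Data.Maybe.Properties using (≡-dec)
open import Data.Nat using (zero; suc; s≤s; _<?_)
import Data.Nat.Properties as ℕₚ
open import Data.Product using (_,_; proj₁; proj₂; ∃)
open import Data.Sum using (_⊎_; inj₁; inj₂)
open import Data.Sum.Properties using (inj₁-injective; inj₂-injective)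
open import Function using (_∘_)
open import Function.Bundles using (mk↔ₛ′)
open import Relation.Nullary using (¬_; yes; no)
open import Relation.Nullary.Decidable using (⌊_⌋; dec-true; dec-false)
open import Relation.Binary.PropositionalEquality
  using (_≡_; _≢_; refl; sym; trans; cong; cong₂; subst; module ≡-Reasoning)

sumFin-zero : ∀ {K} (h : Fin K → ℤ) → (∀ x → h x ≡ 0ℤ) → sumFin h ≡ 0ℤ
sumFin-zero {zero} h h≡0 = refl
sumFin-zero {suc K} h h≡0
  rewrite h≡0 Fin.zero | sumFin-zero (h ∘ Fin.suc) (h≡0 ∘ Fin.suc) = refl

sumFin-point : ∀ {K} (h : Fin K → ℤ) (x₀ : Fin K) → (∀ x → x ≢ x₀ → h x ≡ 0ℤ) →
               sumFin h ≡ h x₀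
sumFin-point h Fin.zero h≡0 rewrite sumFin-zero (h ∘ Fin.suc) (λ x → h≡0 (Fin.suc x) λ ()) =
  ℤₚ.+-identityʳ (h Fin.zero)
sumFin-point h (Fin.suc x₀) h≡0 rewrite h≡0 Fin.zero λ () =
  trans (ℤₚ.+-identityˡ _)
        (sumFin-point (h ∘ Fin.suc) x₀ λ x x≢x₀ → h≡0 (Fin.suc x) (x≢x₀ ∘ suc-injective))

module _ {m n : ℕ} (h : Fin m → Fin n → ℤ) where

  sumVar-zero : (∀ i j → h i j ≡ 0ℤ) → sumVar h ≡ 0ℤ
  sumVar-zero h≡0 = sumFin-zero _ λ i → sumFin-zero _ (h≡0 i)

  sumVar-point : ∀ i₀ j₀ → (∀ i j → h i j ≡ 0ℤ ⊎ (i ≡ i₀ × j ≡ j₀)) → sumVar h ≡ h i₀ j₀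
  sumVar-point i₀ j₀ off =
    trans (sumFin-point _ i₀ λ i i≢i₀ → sumFin-zero _ λ j → offRow i≢i₀ (off i j))
          (sumFin-point _ j₀ λ j j≢j₀ → offColumn j≢j₀ (off i₀ j))
    where
    offRow : ∀ {i j} → i ≢ i₀ → h i j ≡ 0ℤ ⊎ (i ≡ i₀ × j ≡ j₀) → h i j ≡ 0ℤ
    offRow _    (inj₁ h≡0)         = h≡0
    offRow i≢i₀ (inj₂ (i≡i₀ , _)) = ⊥-elim (i≢i₀ i≡i₀)
    offColumn : ∀ {i j} → j ≢ j₀ → h i j ≡ 0ℤ ⊎ (i ≡ i₀ × j ≡ j₀) → h i j ≡ 0ℤ
    offColumn _    (inj₁ h≡0)         = h≡0
    offColumn j≢j₀ (inj₂ (_ , j≡j₀)) = ⊥-elim (j≢j₀ j≡j₀)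

≡0⇒*≡0 : ∀ {c} x → c ≡ 0ℤ → c ℤ.* x ≡ 0ℤ
≡0⇒*≡0 x refl = ℤₚ.*-zeroˡ x

module _ {m n : ℕ} (e : Ineq m n) where

  zeroCoeffs⇒Trivial : (∀ i j → coeff e i j ≡ 0ℤ) → bound e ℤ.≤ 0ℤ → Trivial e
  zeroCoeffs⇒Trivial c≡0 b≤0 α =
    subst (bound e ℤ.≤_) (sym (sumVar-zero _ λ i j → ≡0⇒*≡0 ⟦ α i j ⟧ (c≡0 i j))) b≤0

  singleVar⇒Trivial : ∀ i₀ j₀ → (∀ i j → coeff e i j ≡ 0ℤ ⊎ (i ≡ i₀ × j ≡ j₀)) →
                      bound e ℤ.≤ 0ℤ → bound e ℤ.≤ coeff e i₀ j₀ → Trivial e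
  singleVar⇒Trivial i₀ j₀ off b≤0 b≤c α =
    subst (bound e ℤ.≤_) (sym (sumVar-point _ i₀ j₀ offPoint)) (atPoint (α i₀ j₀))
    where
    offPoint : ∀ i j → coeff e i j ℤ.* ⟦ α i j ⟧ ≡ 0ℤ ⊎ (i ≡ i₀ × j ≡ j₀)
    offPoint i j with off i j
    ... | inj₁ c≡0 = inj₁ (≡0⇒*≡0 ⟦ α i j ⟧ c≡0)
    ... | inj₂ at  = inj₂ at
    atPoint : ∀ b → bound e ℤ.≤ coeff e i₀ j₀ ℤ.* ⟦ b ⟧
    atPoint true  = subst (bound e ℤ.≤_) (sym (ℤₚ.*-identityʳ (coeff e i₀ j₀))) b≤c
    atPoint false = subst (bound e ℤ.≤_) (sym (ℤₚ.*-zeroʳ (coeff e i₀ j₀))) b≤0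

module _ {m n : ℕ} (ρ : Restriction m n) (e : Ineq m n) where

  -- The variable contributes nothing to the constant term of e ↾ ρ.
  Silent : Fin m → Fin n → Set
  Silent i j = coeff e i j ≡ 0ℤ ⊎ ρ i j ≢ just true

  module _ {i : Fin m} {j : Fin n} where

    freeCoeff-free : ρ i j ≡ nothing → freeCoeff ρ e i j ≡ coeff e i j
    freeCoeff-free free with ρ i j
    ... | nothing = refl

    freeCoeff-assigned : ρ i j ≢ nothing → freeCoeff ρ e i j ≡ 0ℤ
    freeCoeff-assigned assigned with ρ i j
    ... | just _  = refl
    ... | nothing = ⊥-elim (assigned refl)

    freeCoeff-zero : coeff e i j ≡ 0ℤ → freeCoeff ρ e i j ≡ 0ℤ
    freeCoeff-zero c≡0 with ρ i j
    ... | just _  = refl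
    ... | nothing = c≡0

    freeCoeff-≥ : ∀ {b} → b ℤ.≤ 0ℤ → b ℤ.≤ coeff e i j → b ℤ.≤ freeCoeff ρ e i j
    freeCoeff-≥ b≤0 b≤c with ρ i j
    ... | just _  = b≤0
    ... | nothing = b≤c

    assignedVal-silent : Silent i j → assignedVal ρ e i j ≡ 0ℤ
    assignedVal-silent silent with ρ i j | silent
    ... | nothing    | _          = refl
    ... | just false | _          = ℤₚ.*-zeroʳ (coeff e i j)
    ... | just true  | inj₁ c≡0   = ≡0⇒*≡0 1ℤ c≡0
    ... | just true  | inj₂ ¬true = ⊥-elim (¬true refl)

    assignedVal-true : ρ i j ≡ just true → assignedVal ρ e i j ≡ coeff e i j
    assignedVal-true ρij≡true with ρ i j
    ... | just true = ℤₚ.*-identityʳ (coeff e i j)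

  assignedSum-zero : (∀ i j → Silent i j) → sumVar (assignedVal ρ e) ≡ 0ℤ
  assignedSum-zero silent = sumVar-zero _ λ i j → assignedVal-silent (silent i j)

  assignedSum-point : ∀ {i₀ j₀} → ρ i₀ j₀ ≡ just true →
                      (∀ i j → Silent i j ⊎ (i ≡ i₀ × j ≡ j₀)) →
                      sumVar (assignedVal ρ e) ≡ coeff e i₀ j₀
  assignedSum-point {i₀} {j₀} ρ≡true off =
    trans (sumVar-point _ i₀ j₀ offPoint) (assignedVal-true ρ≡true)
    where
    offPoint : ∀ i j → assignedVal ρ e i j ≡ 0ℤ ⊎ (i ≡ i₀ × j ≡ j₀)
    offPoint i j with off i j
    ... | inj₁ silent = inj₁ (assignedVal-silent silent)
    ... | inj₂ at     = inj₂ at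

  restrict-bound : sumVar (assignedVal ρ e) ≡ 0ℤ → bound (restrictIneq ρ e) ≡ bound e
  restrict-bound Σ≡0 = trans (cong (λ s → bound e ℤ.- s) Σ≡0) (ℤₚ.+-identityʳ (bound e))

module _ {m n : ℕ} where

  pigeonCoeff-on : ∀ (i : Fin m) (j : Fin n) → coeff (PHPax m n (inj₁ i)) i j ≡ 1ℤ
  pigeonCoeff-on i j with i Fin.≟ i
  ... | yes _  = refl
  ... | no i≢i = ⊥-elim (i≢i refl)

  pigeonCoeff-off : ∀ {i₀ i : Fin m} (j : Fin n) → i ≢ i₀ →
                    coeff (PHPax m n (inj₁ i₀)) i j ≡ 0ℤ
  pigeonCoeff-off {i₀} {i} j i≢i₀ with i Fin.≟ i₀
  ... | yes i≡i₀ = ⊥-elim (i≢i₀ i≡i₀)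
  ... | no _     = refl

  holeCoeff-off : ∀ {k : Fin n} {a b : Fin m} (a≢b : a ≢ b) i j →
                  j ≢ k ⊎ (i ≢ a × i ≢ b) →
                  coeff (PHPax m n (inj₂ (k , (a , b) , a≢b))) i j ≡ 0ℤ
  holeCoeff-off {k} {a} {b} _ i j off with j Fin.≟ k | i Fin.≟ a | i Fin.≟ b | off
  ... | no _    | _       | _       | _              = refl
  ... | yes _   | no _    | no _    | _              = refl
  ... | yes j≡k | _       | _       | inj₁ j≢k       = ⊥-elim (j≢k j≡k)
  ... | yes _   | yes i≡a | _       | inj₂ (i≢a , _) = ⊥-elim (i≢a i≡a)
  ... | yes _   | no _    | yes i≡b | inj₂ (_ , i≢b) = ⊥-elim (i≢b i≡b)

  holeCoeff-≥ : ∀ {k : Fin n} {a b : Fin m} (a≢b : a ≢ b) i j →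
                - 1ℤ ℤ.≤ coeff (PHPax m n (inj₂ (k , (a , b) , a≢b))) i j
  holeCoeff-≥ {k} {a} {b} _ i j with ⌊ j Fin.≟ k ⌋ ∧ (⌊ i Fin.≟ a ⌋ ∨ ⌊ i Fin.≟ b ⌋)
  ... | true  = ℤₚ.≤-refl
  ... | false = -≤+

⌊≟⌋-injective : ∀ {a b} {f : Fin a → Fin b} → (∀ {x y} → f x ≡ f y → x ≡ y) →
                ∀ x y → ⌊ f x Fin.≟ f y ⌋ ≡ ⌊ x Fin.≟ y ⌋
⌊≟⌋-injective {f = f} f-injective x y with f x Fin.≟ f y | x Fin.≟ y
... | yes _   | yes _   = refl
... | no _    | no _    = refl
... | yes fx≡ | no x≢y  = ⊥-elim (x≢y (f-injective fx≡))
... | no fx≢  | yes x≡y = ⊥-elim (fx≢ (cong f x≡y))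

transpose-matchˡ : ∀ {K} (a b : Fin K) → PC.transpose a b a ≡ b
transpose-matchˡ a b rewrite dec-true (a Fin.≟ a) refl = refl

transpose-other : ∀ {K} {a b z : Fin K} → z ≢ a → z ≢ b → PC.transpose a b z ≡ z
transpose-other {a = a} {b} {z} z≢a z≢b
  rewrite dec-false (z Fin.≟ a) z≢a | dec-false (z Fin.≟ b) z≢b = refl

-- Induction on L: an element not yet below v + 1 is swapped with the element
-- of rank v, which lies outside the images of the rest of L (all below v).
prefixPermutation : ∀ {K} v (L : List (Fin K)) → length L ≤ v → v ≤ K →
                    Σ (Permutation′ K) λ π → ∀ {x} → x ∈ L → toℕ (π ⟨$⟩ʳ x) < v
prefixPermutation v [] _ _ = id , λ ()
prefixPermutation (suc v) (x ∷ L) (s≤s |L|≤v) v<K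
  with prefixPermutation v L |L|≤v (ℕₚ.<⇒≤ v<K)
... | π , L<v with toℕ (π ⟨$⟩ʳ x) <? suc v
...   | yes x<1+v = π , λ { (here refl) → x<1+v ; (there y∈L) → ℕₚ.m<n⇒m<1+n (L<v y∈L) }
...   | no x≮1+v = π ∘ₚ transpose (π ⟨$⟩ʳ x) r , below
  where
  r : Fin _
  r = fromℕ< v<K
  πy≢πx : ∀ {y} → y ∈ L → π ⟨$⟩ʳ y ≢ π ⟨$⟩ʳ x
  πy≢πx y∈L eq = x≮1+v (subst (λ z → toℕ z < suc v) eq (ℕₚ.m<n⇒m<1+n (L<v y∈L)))
  πy≢r : ∀ {y} → y ∈ L → π ⟨$⟩ʳ y ≢ r
  πy≢r y∈L eq = ℕₚ.<-irrefl (trans (cong toℕ eq) (toℕ-fromℕ< v<K)) (L<v y∈L)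
  below : ∀ {y} → y ∈ x ∷ L → toℕ (PC.transpose (π ⟨$⟩ʳ x) r (π ⟨$⟩ʳ y)) < suc v
  below (here refl) rewrite transpose-matchˡ (π ⟨$⟩ʳ x) r | toℕ-fromℕ< v<K = ℕₚ.≤-refl
  below (there y∈L) =
    subst (λ z → toℕ z < suc v) (sym (transpose-other (πy≢πx y∈L) (πy≢r y∈L)))
          (ℕₚ.m<n⇒m<1+n (L<v y∈L))

module Ranking {K : ℕ} (v : ℕ) {k′ : ℕ} (π : Permutation K (v + k′)) where

  rank : Fin K → Fin v ⊎ Fin k′
  rank x = splitAt v (π ⟨$⟩ʳ x)

  low : Fin v → Fin K
  low c = π ⟨$⟩ˡ (c ↑ˡ k′)

  high : Fin k′ → Fin K
  high c = π ⟨$⟩ˡ (v ↑ʳ c)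

  rank-low : ∀ c → rank (low c) ≡ inj₁ c
  rank-low c = trans (cong (splitAt v) (inverseʳ π)) (splitAt-↑ˡ v c k′)

  rank-high : ∀ c → rank (high c) ≡ inj₂ c
  rank-high c = trans (cong (splitAt v) (inverseʳ π)) (splitAt-↑ʳ v k′ c)

  low-rank : ∀ {x c} → rank x ≡ inj₁ c → low c ≡ x
  low-rank eq = trans (cong (π ⟨$⟩ˡ_) (splitAt⁻¹-↑ˡ eq)) (inverseˡ π)

  high-rank : ∀ {x c} → rank x ≡ inj₂ c → high c ≡ x
  high-rank eq = trans (cong (π ⟨$⟩ˡ_) (splitAt⁻¹-↑ʳ eq)) (inverseˡ π)

  high-injective : ∀ {c d} → high c ≡ high d → c ≡ d
  high-injective {c} {d} eq =
    inj₂-injective (trans (sym (rank-high c)) (trans (cong rank eq) (rank-high d)))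

  rank-< : ∀ {x} → toℕ (π ⟨$⟩ʳ x) < v → ∃ λ c → rank x ≡ inj₁ c
  rank-< x<v = fromℕ< x<v , splitAt-< v _ x<v

  data View : Fin K → Set where
    is-low  : ∀ c → View (low c)
    is-high : ∀ c → View (high c)

  view : ∀ x → View x
  view x with rank x in eq
  ... | inj₁ c = subst View (low-rank eq) (is-low c)
  ... | inj₂ c = subst View (high-rank eq) (is-high c)

match : ∀ {v m n} → Fin v ⊎ Fin m → Fin v ⊎ Fin n → Maybe Bool
match (inj₁ c) (inj₁ d) = just ⌊ c Fin.≟ d ⌋
match (inj₁ _) (inj₂ _) = just false
match (inj₂ _) (inj₁ _) = just false
match (inj₂ _) (inj₂ _) = nothing

module _ {v m n : ℕ} where

  match-inj₁ˡ : ∀ c (t : Fin v ⊎ Fin n) → match {m = m} (inj₁ c) t ≢ nothing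
  match-inj₁ˡ c (inj₁ d) ()
  match-inj₁ˡ c (inj₂ d) ()

  match-inj₁ʳ : ∀ (s : Fin v ⊎ Fin m) d → match {n = n} s (inj₁ d) ≢ nothing
  match-inj₁ʳ (inj₁ c) d ()
  match-inj₁ʳ (inj₂ c) d ()

  match-inj₂ˡ : ∀ a (t : Fin v ⊎ Fin n) → match {m = m} (inj₂ a) t ≢ just true
  match-inj₂ˡ a (inj₁ d) ()
  match-inj₂ˡ a (inj₂ d) ()

  match-inj₂ʳ : ∀ (s : Fin v ⊎ Fin m) b → match {n = n} s (inj₂ b) ≢ just true
  match-inj₂ʳ (inj₁ c) b ()
  match-inj₂ʳ (inj₂ c) b ()

  match-refl : ∀ (c : Fin v) → match {m = m} {n} (inj₁ c) (inj₁ c) ≡ just true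
  match-refl c with c Fin.≟ c
  ... | yes _  = refl
  ... | no c≢c = ⊥-elim (c≢c refl)

  match-true : ∀ {s : Fin v ⊎ Fin m} {t : Fin v ⊎ Fin n} → match s t ≡ just true →
               ∃ λ c → s ≡ inj₁ c × t ≡ inj₁ c
  match-true {inj₁ c} {inj₁ d} eq with c Fin.≟ d
  match-true {inj₁ c} {inj₁ .c} refl | yes refl = c , refl , refl
  match-true {inj₁ c} {inj₂ d} ()
  match-true {inj₂ c} {inj₁ d} ()
  match-true {inj₂ c} {inj₂ d} ()

  match-nothing : ∀ {s : Fin v ⊎ Fin m} {t : Fin v ⊎ Fin n} → match s t ≡ nothing →
                  (∃ λ a → s ≡ inj₂ a) × (∃ λ b → t ≡ inj₂ b)
  match-nothing {inj₁ c} {t} eq = ⊥-elim (match-inj₁ˡ c t eq)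
  match-nothing {inj₂ a} {inj₁ d} ()
  match-nothing {inj₂ a} {inj₂ b} _ = (a , refl) , (b , refl)

module Matching {M N : ℕ} (v : ℕ) {m′ n′ : ℕ}
                (πP : Permutation M (v + m′)) (πH : Permutation N (v + n′)) where

  module P = Ranking v πP
  module H = Ranking v πH

  ρ : Restriction M N
  ρ i j = match (P.rank i) (H.rank j)

  module _ {i : Fin M} {j : Fin N} where

    assigned-lowP : ∀ {c} → P.rank i ≡ inj₁ c → ρ i j ≢ nothing
    assigned-lowP {c} eq =
      subst (λ s → match s (H.rank j) ≢ nothing) (sym eq) (match-inj₁ˡ c (H.rank j))

    assigned-lowH : ∀ {c} → H.rank j ≡ inj₁ c → ρ i j ≢ nothing
    assigned-lowH {c} eq =
      subst (λ t → match (P.rank i) t ≢ nothing) (sym eq) (match-inj₁ʳ (P.rank i) c)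

    untrue-highP : ∀ {a} → P.rank i ≡ inj₂ a → ρ i j ≢ just true
    untrue-highP {a} eq =
      subst (λ s → match s (H.rank j) ≢ just true) (sym eq) (match-inj₂ˡ a (H.rank j))

    untrue-highH : ∀ {b} → H.rank j ≡ inj₂ b → ρ i j ≢ just true
    untrue-highH {b} eq =
      subst (λ t → match (P.rank i) t ≢ just true) (sym eq) (match-inj₂ʳ (P.rank i) b)

    true-inRow : ∀ {c} → P.rank i ≡ inj₁ c → ρ i j ≡ just true → j ≡ H.low c
    true-inRow eqi ρ≡true with match-true ρ≡true
    ... | _ , eqi′ , eqj rewrite inj₁-injective (trans (sym eqi) eqi′) = sym (H.low-rank eqj)

    true-inColumn : ∀ {c} → H.rank j ≡ inj₁ c → ρ i j ≡ just true → i ≡ P.low c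
    true-inColumn eqj ρ≡true with match-true ρ≡true
    ... | _ , eqi , eqj′ rewrite inj₁-injective (trans (sym eqj) eqj′) = sym (P.low-rank eqi)

  matched : ∀ c → ρ (P.low c) (H.low c) ≡ just true
  matched c = trans (cong₂ match (P.rank-low c) (H.rank-low c)) (match-refl {m = m′} {n′} c)

  unmatched : ∀ a b → ρ (P.high a) (H.high b) ≡ nothing
  unmatched a b = cong₂ match (P.rank-high a) (H.rank-high b)

  highCoords : Free ρ → Fin m′ × Fin n′
  highCoords (_ , free) = proj₁ (proj₁ (match-nothing free)) , proj₁ (proj₂ (match-nothing free))

  highCoords-high : ∀ a b (free : ρ (P.high a) (H.high b) ≡ nothing) →
                    highCoords ((P.high a , H.high b) , free) ≡ (a , b)
  highCoords-high a b free with match-nothing free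
  ... | (_ , eqa) , (_ , eqb) =
    cong₂ _,_ (inj₂-injective (trans (sym eqa) (P.rank-high a)))
              (inj₂-injective (trans (sym eqb) (H.rank-high b)))

  Free-≡ : {x y : Free ρ} → proj₁ x ≡ proj₁ y → x ≡ y
  Free-≡ {p , e} {.p , e′} refl =
    cong (p ,_) (Decidable⇒UIP.≡-irrelevant (≡-dec Boolₚ._≟_) e e′)

  σ : Free ρ ↔ (Fin m′ × Fin n′)
  σ = mk↔ₛ′ highCoords fromHigh highCoords-fromHigh fromHigh-highCoords
    where
    fromHigh : Fin m′ × Fin n′ → Free ρ
    fromHigh (a , b) = (P.high a , H.high b) , unmatched a b
    highCoords-fromHigh : ∀ ab → highCoords (fromHigh ab) ≡ ab
    highCoords-fromHigh (a , b) = highCoords-high a b (unmatched a b)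
    fromHigh-highCoords : ∀ x → fromHigh (highCoords x) ≡ x
    fromHigh-highCoords (_ , free) with match-nothing free
    ... | (_ , eqa) , (_ , eqb) = Free-≡ (cong₂ _,_ (P.high-rank eqa) (H.high-rank eqb))

  renamedEq : (e : Ineq M N) (f : Ineq m′ n′) →
              sumVar (assignedVal ρ e) ≡ 0ℤ → bound e ≡ bound f →
              (∀ a b → coeff e (P.high a) (H.high b) ≡ coeff f a b) →
              RenamedEq ρ σ (restrictIneq ρ e) f
  renamedEq e f Σ≡0 bound≡ coeff≡ = trans (restrict-bound ρ e Σ≡0) bound≡ , coeffs
    where
    coeffs : ∀ (x : Free ρ) → freeCoeff ρ e (proj₁ (proj₁ x)) (proj₂ (proj₁ x))
                            ≡ coeff f (proj₁ (highCoords x)) (proj₂ (highCoords x))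
    coeffs ((i , j) , free) with P.view i | H.view j
    ... | P.is-low c  | _           = ⊥-elim (assigned-lowP (P.rank-low c) free)
    ... | P.is-high _ | H.is-low c  = ⊥-elim (assigned-lowH (H.rank-low c) free)
    ... | P.is-high a | H.is-high b = begin
      freeCoeff ρ e (P.high a) (H.high b) ≡⟨ freeCoeff-free ρ e free ⟩
      coeff e (P.high a) (H.high b)       ≡⟨ coeff≡ a b ⟩
      coeff f a b                         ≡⟨ cong (λ (a , b) → coeff f a b) (highCoords-high a b free) ⟨
      coeff f _ _                         ∎
      where open ≡-Reasoning

  pigeonHigh-silent : ∀ a i j → Silent ρ (PHPax M N (inj₁ (P.high a))) i j
  pigeonHigh-silent a i j with i Fin.≟ P.high a
  ... | yes refl = inj₂ (untrue-highP (P.rank-high a))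
  ... | no _     = inj₁ refl

  holeHigh-silent : ∀ k {x y} (x≢y : x ≢ y) i j →
                    Silent ρ (PHPax M N (inj₂ (H.high k , (x , y) , x≢y))) i j
  holeHigh-silent k x≢y i j with j Fin.≟ H.high k
  ... | yes refl = inj₂ (untrue-highH (H.rank-high k))
  ... | no _     = inj₁ refl

  -- The matched hole H.low c is the only 1 of the row of P.low c: 1 - 1 ≥ 0.
  pigeonLow-trivial : ∀ c → Trivial (restrictIneq ρ (PHPax M N (inj₁ (P.low c))))
  pigeonLow-trivial c = zeroCoeffs⇒Trivial _ unassigned (ℤₚ.≤-reflexive bound≡0)
    where
    e : Ineq M N
    e = PHPax M N (inj₁ (P.low c))
    unassigned : ∀ i j → freeCoeff ρ e i j ≡ 0ℤ
    unassigned i j with i Fin.≟ P.low c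
    ... | yes refl = freeCoeff-assigned ρ e (assigned-lowP (P.rank-low c))
    ... | no i≢    = freeCoeff-zero ρ e (pigeonCoeff-off j i≢)
    onlyMatch : ∀ i j → Silent ρ e i j ⊎ (i ≡ P.low c × j ≡ H.low c)
    onlyMatch i j with i Fin.≟ P.low c | j Fin.≟ H.low c
    ... | no _     | _      = inj₁ (inj₁ refl)
    ... | yes i≡   | yes j≡ = inj₂ (i≡ , j≡)
    ... | yes refl | no j≢  = inj₁ (inj₂ (j≢ ∘ true-inRow (P.rank-low c)))
    bound≡0 : 1ℤ ℤ.- sumVar (assignedVal ρ e) ≡ 0ℤ
    bound≡0 = cong (λ s → 1ℤ ℤ.- s)
      (trans (assignedSum-point ρ e (matched c) onlyMatch) (pigeonCoeff-on (P.low c) (H.low c)))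

  -- The matched pigeon P.low c carries the only 1 of the column of H.low c.
  holeLow-trivial : ∀ c {x y} (x≢y : x ≢ y) →
                    Trivial (restrictIneq ρ (PHPax M N (inj₂ (H.low c , (x , y) , x≢y))))
  holeLow-trivial c x≢y = zeroCoeffs⇒Trivial _ unassigned (ℤₚ.i≤j⇒i-j≤0 -1≤Σ)
    where
    e : Ineq M N
    e = PHPax M N (inj₂ (H.low c , (_ , _) , x≢y))
    unassigned : ∀ i j → freeCoeff ρ e i j ≡ 0ℤ
    unassigned i j with j Fin.≟ H.low c
    ... | yes refl = freeCoeff-assigned ρ e (assigned-lowH (H.rank-low c))
    ... | no j≢    = freeCoeff-zero ρ e (holeCoeff-off x≢y i j (inj₁ j≢))
    onlyMatch : ∀ i j → Silent ρ e i j ⊎ (i ≡ P.low c × j ≡ H.low c)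
    onlyMatch i j with j Fin.≟ H.low c | i Fin.≟ P.low c
    ... | no _     | _      = inj₁ (inj₁ refl)
    ... | yes j≡   | yes i≡ = inj₂ (i≡ , j≡)
    ... | yes refl | no i≢  = inj₁ (inj₂ (i≢ ∘ true-inColumn (H.rank-low c)))
    -1≤Σ : - 1ℤ ℤ.≤ sumVar (assignedVal ρ e)
    -1≤Σ = subst (- 1ℤ ℤ.≤_) (sym (assignedSum-point ρ e (matched c) onlyMatch))
                 (holeCoeff-≥ {k = H.low c} x≢y (P.low c) (H.low c))

  -- With pigeon P.low c of the pair assigned 0, only P_{y,k} survives: -P_{y,k} ≥ -1.
  holeHigh-pigeonLow-trivial : ∀ k c y {a b} (a≢b : a ≢ b) →
                               (∀ i → i ≢ P.low c → i ≢ y → i ≢ a × i ≢ b) →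
                               Trivial (restrictIneq ρ (PHPax M N (inj₂ (H.high k , (a , b) , a≢b))))
  holeHigh-pigeonLow-trivial k c y a≢b outside =
    singleVar⇒Trivial _ y (H.high k) onlyY (subst (ℤ._≤ 0ℤ) (sym bound≡) -≤+)
      (subst (ℤ._≤ freeCoeff ρ e y (H.high k)) (sym bound≡)
             (freeCoeff-≥ ρ e -≤+ (holeCoeff-≥ {k = H.high k} a≢b y (H.high k))))
    where
    e : Ineq M N
    e = PHPax M N (inj₂ (H.high k , (_ , _) , a≢b))
    bound≡ : bound (restrictIneq ρ e) ≡ - 1ℤ
    bound≡ = restrict-bound ρ e (assignedSum-zero ρ e (holeHigh-silent k a≢b))
    onlyY : ∀ i j → freeCoeff ρ e i j ≡ 0ℤ ⊎ (i ≡ y × j ≡ H.high k)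
    onlyY i j with j Fin.≟ H.high k | i Fin.≟ P.low c | i Fin.≟ y
    ... | no j≢  | _        | _      = inj₁ (freeCoeff-zero ρ e (holeCoeff-off a≢b i j (inj₁ j≢)))
    ... | yes _  | yes refl | _      = inj₁ (freeCoeff-assigned ρ e (assigned-lowP (P.rank-low c)))
    ... | yes j≡ | no _     | yes i≡ = inj₂ (i≡ , j≡)
    ... | yes _  | no i≢c   | no i≢y =
      inj₁ (freeCoeff-zero ρ e (holeCoeff-off a≢b i j (inj₂ (outside i i≢c i≢y))))

  pigeonHigh-renamed : ∀ a → RenamedEq ρ σ (restrictIneq ρ (PHPax M N (inj₁ (P.high a))))
                                         (PHPax m′ n′ (inj₁ a))
  pigeonHigh-renamed a =
    renamedEq _ _ (assignedSum-zero ρ _ (pigeonHigh-silent a)) refl λ a′ _ →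
      cong (λ t → if t then 1ℤ else 0ℤ) (⌊≟⌋-injective P.high-injective a′ a)

  holeHigh-renamed : ∀ k {a b} (a≢b : a ≢ b) (ha≢hb : P.high a ≢ P.high b) →
    RenamedEq ρ σ (restrictIneq ρ (PHPax M N (inj₂ (H.high k , (P.high a , P.high b) , ha≢hb))))
                  (PHPax m′ n′ (inj₂ (k , (a , b) , a≢b)))
  holeHigh-renamed k {a} {b} _ ha≢hb =
    renamedEq _ _ (assignedSum-zero ρ _ (holeHigh-silent k ha≢hb)) refl λ a′ b′ →
      cong (λ t → if t then - 1ℤ else 0ℤ)
        (cong₂ _∧_ (⌊≟⌋-injective H.high-injective b′ k)
                   (cong₂ _∨_ (⌊≟⌋-injective P.high-injective a′ a)
                              (⌊≟⌋-injective P.high-injective a′ b)))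

  PHP↾ρ≅PHP : EqUpToRenaming (PHP M N) ρ (PHP m′ n′) σ
  PHP↾ρ≅PHP = surviving , reached
    where
    surviving : ∀ l → ¬ Trivial (restrictIneq ρ (PHPax M N l)) →
                Σ (PHPIdx m′ n′) λ l′ →
                  RenamedEq ρ σ (restrictIneq ρ (PHPax M N l)) (PHPax m′ n′ l′)
    surviving (inj₁ i) nontrivial with P.view i
    ... | P.is-low c  = ⊥-elim (nontrivial (pigeonLow-trivial c))
    ... | P.is-high a = inj₁ a , pigeonHigh-renamed a
    surviving (inj₂ (k , (x , y) , x≢y)) nontrivial with H.view k | P.view x | P.view y
    ... | H.is-low c   | _           | _           = ⊥-elim (nontrivial (holeLow-trivial c x≢y))
    ... | H.is-high k′ | P.is-low c  | _           =
      ⊥-elim (nontrivial (holeHigh-pigeonLow-trivial k′ c y x≢y λ _ i≢x i≢y → i≢x , i≢y))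
    ... | H.is-high k′ | P.is-high _ | P.is-low c  =
      ⊥-elim (nontrivial (holeHigh-pigeonLow-trivial k′ c x x≢y λ _ i≢y i≢x → i≢x , i≢y))
    ... | H.is-high k′ | P.is-high a | P.is-high b =
      inj₂ (k′ , (a , b) , x≢y ∘ cong P.high) , holeHigh-renamed k′ (x≢y ∘ cong P.high) x≢y
    reached : ∀ l′ → Σ (PHPIdx M N) λ l →
                RenamedEq ρ σ (restrictIneq ρ (PHPax M N l)) (PHPax m′ n′ l′)
    reached (inj₁ a) = inj₁ (P.high a) , pigeonHigh-renamed a
    reached (inj₂ (k , (a , b) , a≢b)) =
      inj₂ (H.high k , (P.high a , P.high b) , a≢b ∘ P.high-injective) ,
      holeHigh-renamed k a≢b (a≢b ∘ P.high-injective)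

mainTheorem15 : (d : ℕ) → 1 ≤ d → (n : ℕ) →
    (I : List (Fin (n + d) × Fin n)) → Unique I → length I < n →
    Σ (Restriction (n + d) n) (λ ρ →
      ((x : Fin (n + d) × Fin n) → x ∈ I → InDom ρ x) ×
      Σ (Free ρ ↔ (Fin ((n ∸ length I) + d) × Fin (n ∸ length I))) (λ σ →
        EqUpToRenaming (PHP (n + d) n) ρ (PHP ((n ∸ length I) + d) (n ∸ length I)) σ))
mainTheorem15 d _ n I _ |I|<n = ρ , inDom , σ , PHP↾ρ≅PHP
  where
  v : ℕ
  v = length I
  v+[n∸v]≡n : v + (n ∸ v) ≡ n
  v+[n∸v]≡n = ℕₚ.m+[n∸m]≡n (ℕₚ.<⇒≤ |I|<n)
  prefix : Σ (Permutation′ (n + d)) λ π → ∀ {i} → i ∈ map proj₁ I → toℕ (π ⟨$⟩ʳ i) < v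
  prefix = prefixPermutation v (map proj₁ I) (ℕₚ.≤-reflexive (length-map proj₁ I))
             (ℕₚ.≤-trans (ℕₚ.<⇒≤ |I|<n) (ℕₚ.m≤m+n n d))
  πP : Permutation (n + d) (v + (n ∸ v + d))
  πP = proj₁ prefix ∘ₚ cast-id (sym (trans (sym (ℕₚ.+-assoc v (n ∸ v) d)) (cong (_+ d) v+[n∸v]≡n)))
  πH : Permutation n (v + (n ∸ v))
  πH = cast-id (sym v+[n∸v]≡n)
  open Matching v πP πH
  inDom : (x : Fin (n + d) × Fin n) → x ∈ I → InDom ρ x
  inDom (i , j) x∈I =
    assigned-lowP (proj₂ (P.rank-< (subst (_< v) (sym (toℕ-cast _ _)) i<v)))
    where
    i<v : toℕ (proj₁ prefix ⟨$⟩ʳ i) < v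
    i<v = proj₂ prefix (∈-map⁺ proj₁ x∈I)
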